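{- For a connected simple graph $G=(V,E)$ with $n=|V|$ and $m=|E|\ge n$, we have $|\Omega_{\mathrm{cycle}}^{\mathrm{var}}|\le n\,|\Omega_0|$.
   Context: An assignment is a choice $\sigma=(a_v)_{v\in V}$ where each $a_v=(v,w)$ is an arc from $v$ to some neighbour $w$ of $v$. For each edge $e=\{u,v\}$, $B_e$ is the event that $a_u=(u,v)$ and $a_v=(v,u)$; for each cycle $C$ of $G$ (length at least 3) an orientation is fixed arbitrarily and $B_C$ is the event that each $a_v$, $v\in C$, is the arc leaving $v$ along $C$ in that orientation. $\Omega_0$ is the set of assignments in which none of the events $B_e$, $B_C$ occurs; $\Omega_C$ is the set of assignments in which $B_C$ occurs and no other of these events occurs; $\Omega_{\mathrm{cycle}}^{\mathrm{var}}=\{(\sigma,v):\exists\text{ cycle }C,\ \sigma\in\Omega_C,\ v\in C\}$. -}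

module Defs where

open import Data.Nat using (ℕ; zero; suc; _≤_; _<ᵇ_)
open import Data.Fin using (Fin; toℕ)
open import Data.Bool using (Bool; true; false; not; _∧_; T)
open import Data.Bool.Properties using (T?)
open import Data.Vec using (Vec; []; _∷_; lookup)
open import Data.List using (List; []; _∷_; _++_; [_]; length; filter; map; concatMap;
  cartesianProduct; allFin; zip; drop; take; reverse)
open import Data.List.Relation.Unary.All using (All)
open import Data.List.Relation.Unary.Unique.Propositional using (Unique)
open import Data.List.Membership.Propositional using (_∈_)
open import Data.Product using (Σ; ∃; ∃-syntax; _×_; _,_)
open import Relation.Nullary using (¬_)
open import Relation.Unary using (Pred; Decidable)
open import Relation.Binary.PropositionalEquality using (_≡_)
open import Level using (0ℓ)

Graph : ℕ → Set
Graph n = Fin n → Fin n → Bool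

Adj : ∀ {n} → Graph n → Fin n → Fin n → Set
Adj G u v = G u v ≡ true

IsSimple : ∀ {n} → Graph n → Set
IsSimple {n} G = (∀ (u v : Fin n) → G u v ≡ G v u) × (∀ (v : Fin n) → G v v ≡ false)

data Reach {n} (G : Graph n) : Fin n → Fin n → Set where
  here : ∀ {u} → Reach G u u
  step : ∀ {u v w} → Adj G u v → Reach G v w → Reach G u w

Connected : ∀ {n} → Graph n → Set
Connected {n} G = ∀ (u v : Fin n) → Reach G u v

count : ∀ {A : Set} {P : Pred A 0ℓ} → Decidable P → List A → ℕ
count P? xs = length (filter P? xs)

edgeCount : ∀ {n} → Graph n → ℕ
edgeCount {n} G =
  count (λ (p : Fin n × Fin n) → T? (isEdge p)) (cartesianProduct (allFin n) (allFin n))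
  where
  isEdge : Fin n × Fin n → Bool
  isEdge (i , j) = (toℕ i <ᵇ toℕ j) ∧ G i j

-- assignments are vectors σ with σ[v] = the head of the arc a_v = (v , σ[v])
allVecs : ∀ {A : Set} → List A → (k : ℕ) → List (Vec A k)
allVecs xs zero = [] ∷ []
allVecs xs (suc k) = concatMap (λ x → map (x ∷_) (allVecs xs k)) xs

allMaps : (n : ℕ) → List (Vec (Fin n) n)
allMaps n = allVecs (allFin n) n

IsAssignment : ∀ {n} → Graph n → Vec (Fin n) n → Set
IsAssignment {n} G σ = ∀ (v : Fin n) → Adj G v (lookup σ v)

rot : ∀ {A : Set} → List A → List A
rot [] = []
rot (x ∷ xs) = xs ++ [ x ]

cyclicPairs : ∀ {A : Set} → List A → List (A × A)
cyclicPairs l = zip l (rot l)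

-- an oriented cycle of G, given as a vertex sequence (length ≥ 3, distinct,
-- consecutive vertices and last/first adjacent)
IsCycle : ∀ {n} → Graph n → List (Fin n) → Set
IsCycle G l = (3 ≤ length l) × Unique l × All (λ p → Adj G (Data.Product.proj₁ p) (Data.Product.proj₂ p)) (cyclicPairs l)

-- two sequences describe the same oriented cycle (rotation)
SameOriented : ∀ {n} → List (Fin n) → List (Fin n) → Set
SameOriented l l' = ∃[ i ] (l' ≡ drop i l ++ take i l)

-- a choice of orientation for each cycle: ch l = true iff l is the chosen orientation.
-- It must be rotation invariant and pick exactly one of the two orientations.
OrientationChoice : ∀ {n} → Graph n → (List (Fin n) → Bool) → Set
OrientationChoice {n} G ch =
  ∀ (l : List (Fin n)) → IsCycle G l → (ch (rot l) ≡ ch l) × (ch (reverse l) ≡ not (ch l))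

BEdge : ∀ {n} → Graph n → Vec (Fin n) n → Set
BEdge {n} G σ = ∃[ u ] ∃[ v ] (Adj G u v × lookup σ u ≡ v × lookup σ v ≡ u)

BCycleSeq : ∀ {n} → Vec (Fin n) n → List (Fin n) → Set
BCycleSeq σ l = All (λ p → lookup σ (Data.Product.proj₁ p) ≡ Data.Product.proj₂ p) (cyclicPairs l)

ChosenCycle : ∀ {n} → Graph n → (List (Fin n) → Bool) → List (Fin n) → Set
ChosenCycle G ch l = IsCycle G l × ch l ≡ true

Ω₀ : ∀ {n} → Graph n → (List (Fin n) → Bool) → Vec (Fin n) n → Set
Ω₀ {n} G ch σ =
  IsAssignment G σ × ¬ BEdge G σ
  × (∀ (l : List (Fin n)) → ChosenCycle G ch l → ¬ BCycleSeq σ l)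

-- σ ∈ Ω_C where C is the cycle whose chosen orientation is l
ΩC : ∀ {n} → Graph n → (List (Fin n) → Bool) → List (Fin n) → Vec (Fin n) n → Set
ΩC {n} G ch l σ =
  IsAssignment G σ × BCycleSeq σ l × ¬ BEdge G σ
  × (∀ (l' : List (Fin n)) → ChosenCycle G ch l' → BCycleSeq σ l' → SameOriented l l')

ΩcycleVar : ∀ {n} → Graph n → (List (Fin n) → Bool) → Vec (Fin n) n × Fin n → Set
ΩcycleVar {n} G ch (σ , v) = ∃[ l ] (ChosenCycle G ch l × ΩC G ch l σ × v ∈ l)

module Submission where

-- Let σ ∈ Ω_C and v ∈ C.  Flipping σ along C (re-pointing every vertex of C
-- to its predecessor on C, keeping σ elsewhere) yields an assignment τ ∈ Ω₀:
-- an edge event of τ would be one of σ; a chosen cycle of τ meeting C shares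
-- a rotation with the reversal of C, whose orientation is not the chosen one;
-- and a chosen cycle of τ avoiding C would be a second cycle event of σ.  The
-- map (σ , v) ↦ (τ , v) is injective: the cycles of τ through v are rotations
-- of one orbit of τ, so they determine the vertices of C, and on C σ is read
-- off τ backwards.  Hence Ω_cycle^var injects into Ω₀ × V.

open import Defs
open import Data.Nat using (ℕ; zero; suc; _≤_; _<_; _*_; _+_; z≤n; s≤s)
open import Data.Nat.Properties using (*-suc; *-zeroʳ; ≤-trans; <-cmp; suc-injective; module ≤-Reasoning)
open import Data.Nat.GeneralisedArithmetic using () renaming (iterate to iterateℕ)
open import Data.Fin using (Fin) renaming (_≟_ to _≟F_)
open import Data.Bool using (Bool; true; false; not)
open import Data.Maybe using (Maybe; just; nothing; fromMaybe)
open import Data.Vec using (Vec; []; _∷_; lookup; tabulate)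
open import Data.Vec.Properties using (lookup∘tabulate; tabulate∘lookup; tabulate-cong)
import Data.Vec.Properties as Vec
open import Data.List using (List; []; _∷_; _++_; [_]; length; filter; map; zip;
  reverse; drop; take; allFin; cartesianProduct; iterate)
open import Data.List.Properties using (length-++; filter-++; filter-all; filter-none;
  filter-notAll; length-map; ++-assoc; ++-identityʳ; unfold-reverse; take++drop≡id;
  length-tabulate)
open import Data.List.Relation.Unary.All as All using (All; []; _∷_)
open import Data.List.Relation.Unary.All.Properties.Core using (¬Any⇒All¬)
import Data.List.Relation.Unary.All.Properties as All
open import Data.List.Relation.Unary.Any as Any using (Any; here; there)
import Data.List.Relation.Unary.AllPairs as AllPairs
import Data.List.Relation.Unary.AllPairs.Properties as AllPairs
open import Data.List.Relation.Unary.Unique.Propositional using (Unique)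
open import Data.List.Relation.Unary.Unique.Propositional.Properties as Unique
  using (concat⁺; cartesianProduct⁺; allFin⁺; filter⁺)
open import Data.List.Relation.Binary.Disjoint.Propositional using (Disjoint)
open import Data.List.Membership.Propositional using (_∈_; _∉_; find)
open import Data.List.Membership.Propositional.Properties using (∈-filter⁺; ∈-filter⁻;
  ∈-cartesianProduct⁺; ∈-allFin; ∈-concatMap⁺; ∈-map⁺; ∈-map⁻; ∈-∃++; ∈-length)
import Data.List.Membership.DecPropositional as DecMembership
open import Data.Product using (∃; ∃-syntax; _×_; _,_; proj₁; proj₂)
import Data.Product.Properties as Product
open import Data.Empty using (⊥-elim)
open import Relation.Nullary using (¬_; yes; no; ¬?)
open import Relation.Unary using (Pred; Decidable)
open import Relation.Binary.Definitions using (DecidableEquality; tri<; tri≈; tri>)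
open import Relation.Binary.PropositionalEquality using (_≡_; _≢_; refl; sym; trans; cong; subst;
  setoid; module ≡-Reasoning)
import Data.List.Relation.Binary.Permutation.Setoid as PermutationSetoid
import Data.List.Relation.Binary.Permutation.Setoid.Properties as PermutationProperties
open import Level using (0ℓ)

length-≤-by-injection : {X Y : Set} → DecidableEquality Y → (R : X → Y → Set)
  → (xs : List X) (ys : List Y) → Unique xs
  → (∀ {x} → x ∈ xs → ∃ λ y → y ∈ ys × R x y)
  → (∀ {x x' y} → R x y → R x' y → x ≡ x')
  → length xs ≤ length ys
length-≤-by-injection _≟_ R [] ys _ _ _ = z≤n
length-≤-by-injection {X} {Y} _≟_ R (x ∷ xs) ys (x∉xs AllPairs.∷ xs-unique) total injective
  with total (here refl)
... | y , y∈ys , xRy = ≤-trans (s≤s rest≤) ys'<ys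
  where
  ≢y? : Decidable (_≢ y)
  ≢y? z = ¬? (z ≟ y)
  ys' : List Y
  ys' = filter ≢y? ys
  total' : ∀ {x'} → x' ∈ xs → ∃ λ y' → y' ∈ ys' × R x' y'
  total' {x'} x'∈xs with total (there x'∈xs)
  ... | y' , y'∈ys , x'Ry' = y' , ∈-filter⁺ ≢y? y'∈ys y'≢y , x'Ry'
    where
    y'≢y : y' ≢ y
    y'≢y refl = All.lookup x∉xs x'∈xs (injective xRy x'Ry')
  rest≤ : length xs ≤ length ys'
  rest≤ = length-≤-by-injection _≟_ R xs ys' xs-unique total' injective
  ys'<ys : length ys' < length ys
  ys'<ys = filter-notAll ≢y? ys (Any.map (λ { refl y≢y → y≢y refl }) y∈ys)

count-first : {X Y : Set} {P : Pred X 0ℓ} (P? : Decidable P) (xs : List X) (ys : List Y)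
  → count (λ p → P? (proj₁ p)) (cartesianProduct xs ys) ≡ length ys * count P? xs
count-first P? [] ys = sym (*-zeroʳ (length ys))
count-first {X} {Y} {P} P? (x ∷ xs) ys =
  begin
    count Q (map (x ,_) ys ++ cartesianProduct xs ys)
  ≡⟨ cong length (filter-++ Q (map (x ,_) ys) (cartesianProduct xs ys)) ⟩
    length (row ++ filter Q (cartesianProduct xs ys))
  ≡⟨ length-++ row ⟩
    length row + count Q (cartesianProduct xs ys)
  ≡⟨ cong (length row +_) (count-first P? xs ys) ⟩
    length row + length ys * count P? xs
  ≡⟨ row-step ⟩
    length ys * count P? (x ∷ xs)
  ∎
  where
  open ≡-Reasoning
  Q : Decidable (λ (p : X × Y) → P (proj₁ p))
  Q p = P? (proj₁ p)
  row : List (X × Y)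
  row = filter Q (map (x ,_) ys)
  -- the row x × ys is kept entirely or dropped entirely
  row-step : length row + length ys * count P? xs ≡ length ys * count P? (x ∷ xs)
  row-step with P? x
  ... | yes px = trans (cong (_+ length ys * count P? xs) row-full) (sym (*-suc (length ys) _))
    where
    row-full : length row ≡ length ys
    row-full = trans (cong length (filter-all Q (All.map⁺ {f = x ,_} (All.tabulate {xs = ys} λ _ → px))))
                     (length-map (x ,_) ys)
  ... | no ¬px = cong (λ r → length r + length ys * count P? xs)
                      (filter-none Q (All.map⁺ {f = x ,_} (All.tabulate {xs = ys} λ _ → ¬px)))

∈-allVecs : {A : Set} (xs : List A) → (∀ x → x ∈ xs) → ∀ k (v : Vec A k) → v ∈ allVecs xs k
∈-allVecs xs complete zero [] = here refl
∈-allVecs xs complete (suc k) (x ∷ v) =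
  ∈-concatMap⁺ (λ y → map (y ∷_) (allVecs xs k))
    (Any.map (λ { refl → ∈-map⁺ (x ∷_) (∈-allVecs xs complete k v) }) (complete x))

unique-allVecs : {A : Set} (xs : List A) → Unique xs → ∀ k → Unique (allVecs xs k)
unique-allVecs xs unique zero = [] AllPairs.∷ AllPairs.[]
unique-allVecs {A} xs unique (suc k) =
  concat⁺ (All.map⁺ (All.tabulate λ _ → Unique.map⁺ Vec.∷-injectiveʳ (unique-allVecs xs unique k)))
          (AllPairs.map⁺ (AllPairs.map rows-disjoint unique))
  where
  rows-disjoint : ∀ {x y : A} → x ≢ y → Disjoint (map (x ∷_) (allVecs xs k)) (map (y ∷_) (allVecs xs k))
  rows-disjoint x≢y (v∈x-row , v∈y-row) with ∈-map⁻ _ v∈x-row | ∈-map⁻ _ v∈y-row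
  ... | _ , _ , refl | _ , _ , e = x≢y (Vec.∷-injectiveˡ e)

-- A list l = l₀ ∷ … ∷ lₖ is read as the closed walk l₀ → l₁ → … → lₖ → l₀,
-- whose arcs are cyclicPairs l = zip l (rot l).  A map f follows l when it
-- sends every vertex of l to the next one; BCycleSeq σ l is Follows (lookup σ) l.

Follows : {A : Set} → (A → A) → List A → Set
Follows f l = All (λ p → f (proj₁ p) ≡ proj₂ p) (cyclicPairs l)

module _ {A B : Set} where

  zip-∈ : ∀ {a : A} {b : B} xs ys → (a , b) ∈ zip xs ys → a ∈ xs × b ∈ ys
  zip-∈ (x ∷ xs) (y ∷ ys) (here refl) = here refl , here refl
  zip-∈ (x ∷ xs) (y ∷ ys) (there p) with zip-∈ xs ys p
  ... | a∈xs , b∈ys = there a∈xs , there b∈ys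

  zip-second-unique : ∀ {a a' : A} {b : B} xs ys → Unique ys
    → (a , b) ∈ zip xs ys → (a' , b) ∈ zip xs ys → a ≡ a'
  zip-second-unique (x ∷ xs) (y ∷ ys) _ (here refl) (here refl) = refl
  zip-second-unique (x ∷ xs) (y ∷ ys) (y∉ys AllPairs.∷ _) (here refl) (there p) =
    ⊥-elim (All.lookup y∉ys (proj₂ (zip-∈ xs ys p)) refl)
  zip-second-unique (x ∷ xs) (y ∷ ys) (y∉ys AllPairs.∷ _) (there p) (here refl) =
    ⊥-elim (All.lookup y∉ys (proj₂ (zip-∈ xs ys p)) refl)
  zip-second-unique (x ∷ xs) (y ∷ ys) (_ AllPairs.∷ unique) (there p) (there p') =
    zip-second-unique xs ys unique p p'

  zip-partnerˡ : ∀ {b : B} (xs : List A) ys → length xs ≡ length ys → b ∈ ys → ∃[ a ] (a , b) ∈ zip xs ys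
  zip-partnerˡ (x ∷ xs) (y ∷ ys) _ (here refl) = x , here refl
  zip-partnerˡ (x ∷ xs) (y ∷ ys) e (there p) with zip-partnerˡ xs ys (suc-injective e) p
  ... | a , q = a , there q

  zip-partnerʳ : ∀ {a : A} xs (ys : List B) → length xs ≡ length ys → a ∈ xs → ∃[ b ] (a , b) ∈ zip xs ys
  zip-partnerʳ (x ∷ xs) (y ∷ ys) _ (here refl) = y , here refl
  zip-partnerʳ (x ∷ xs) (y ∷ ys) e (there p) with zip-partnerʳ xs ys (suc-injective e) p
  ... | b , q = b , there q

module _ {A : Set} where

  open PermutationSetoid (setoid A) using (_↭_; ↭-refl; ↭-sym; ↭-trans; ↭-prep)
  open PermutationProperties (setoid A)
    using (∈-resp-↭; Unique-resp-↭; xs↭ys⇒|xs|≡|ys|; ∷↭∷ʳ; ↭-reverse; ++-comm)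

  -- Rotation.  All rotations of l are permutations of l, so they have the same
  -- vertices, length and duplicate-freeness.

  rotate : ℕ → List A → List A
  rotate zero l = l
  rotate (suc k) l = rotate k (rot l)

  rotate-preserves : (P : List A → Set) → (∀ l → P l → P (rot l)) → ∀ k l → P l → P (rotate k l)
  rotate-preserves P preserved zero l p = p
  rotate-preserves P preserved (suc k) l p = rotate-preserves P preserved k (rot l) (preserved l p)

  rot-↭ : ∀ (l : List A) → rot l ↭ l
  rot-↭ [] = ↭-refl
  rot-↭ (x ∷ xs) = ↭-sym (∷↭∷ʳ x xs)

  rotate-↭ : ∀ k (l : List A) → rotate k l ↭ l
  rotate-↭ zero l = ↭-refl
  rotate-↭ (suc k) l = ↭-trans (rotate-↭ k (rot l)) (rot-↭ l)

  rotate-split : ∀ p q → rotate (length p) (p ++ q) ≡ q ++ p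
  rotate-split [] q = sym (++-identityʳ q)
  rotate-split (x ∷ p) q =
    trans (cong (rotate (length p)) (++-assoc p q [ x ]))
      (trans (rotate-split p (q ++ [ x ])) (++-assoc q [ x ] p))

  drop++take-↭ : ∀ i (l : List A) → drop i l ++ take i l ↭ l
  drop++take-↭ i l = subst (drop i l ++ take i l ↭_) (take++drop≡id i l) (++-comm (drop i l) (take i l))

  -- The arcs of the walk x → xs → z; cyclicPairs (x ∷ xs) is pathArcs x xs x.
  pathArcs : A → List A → A → List (A × A)
  pathArcs x xs z = zip (x ∷ xs) (xs ++ [ z ])

  pathArcs-snoc : ∀ {P : A × A → Set} a ys b c
    → All P (pathArcs a ys b) → P (b , c) → All P (pathArcs a (ys ++ [ b ]) c)
  pathArcs-snoc a [] b c (p ∷ []) q = p ∷ q ∷ []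
  pathArcs-snoc a (y ∷ ys) b c (p ∷ ps) q = p ∷ pathArcs-snoc y ys b c ps q

  -- rotating a cycle only moves its first arc to the end
  rot-arcs : ∀ {P : A × A → Set} l → All P (cyclicPairs l) → All P (cyclicPairs (rot l))
  rot-arcs [] ps = ps
  rot-arcs (x ∷ []) ps = ps
  rot-arcs (x ∷ y ∷ ys) (p ∷ ps) = pathArcs-snoc y ys x y ps p

  arc-endpoints : ∀ l {a b : A} → (a , b) ∈ cyclicPairs l → a ∈ l × b ∈ l
  arc-endpoints l p with zip-∈ l (rot l) p
  ... | a∈l , b∈rot = a∈l , ∈-resp-↭ (rot-↭ l) b∈rot

  predecessor-exists : ∀ l {y : A} → y ∈ l → ∃[ a ] (a , y) ∈ cyclicPairs l
  predecessor-exists l p =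
    zip-partnerˡ l (rot l) (xs↭ys⇒|xs|≡|ys| (↭-sym (rot-↭ l))) (∈-resp-↭ (↭-sym (rot-↭ l)) p)

  successor-exists : ∀ l {y : A} → y ∈ l → ∃[ b ] (y , b) ∈ cyclicPairs l
  successor-exists l p = zip-partnerʳ l (rot l) (xs↭ys⇒|xs|≡|ys| (↭-sym (rot-↭ l))) p

  predecessor-unique : ∀ l {a a' b : A} → Unique l
    → (a , b) ∈ cyclicPairs l → (a' , b) ∈ cyclicPairs l → a ≡ a'
  predecessor-unique l u = zip-second-unique l (rot l) (Unique-resp-↭ (↭-sym (rot-↭ l)) u)

  -- Orbits.  iterate f w k = w ∷ f w ∷ … ∷ fᵏ⁻¹ w and iterateℕ f w k = fᵏ w.

  pathArcs-orbit : ∀ (f : A → A) x xs z → All (λ p → f (proj₁ p) ≡ proj₂ p) (pathArcs x xs z)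
    → x ∷ xs ≡ iterate f x (suc (length xs)) × iterateℕ f x (suc (length xs)) ≡ z
  pathArcs-orbit f x [] z (fx≡z ∷ []) = refl , fx≡z
  pathArcs-orbit f x (y ∷ ys) z (fx≡y ∷ ps) with pathArcs-orbit f y ys z ps
  ... | orbit , end rewrite fx≡y = cong (x ∷_) orbit , end

  follows⇒orbit : ∀ (f : A → A) l {w} → Follows f l → w ∈ l
    → ∃[ k ] rotate k l ≡ iterate f w (length l) × iterateℕ f w (length l) ≡ w
  follows⇒orbit f l {w} follows w∈l with ∈-∃++ w∈l
  ... | p , s , refl =
    length p , trans split (trans (proj₁ orbit) (cong (iterate f w) len))
             , subst (λ m → iterateℕ f w m ≡ w) len (proj₂ orbit)
    where
    split : rotate (length p) (p ++ w ∷ s) ≡ w ∷ s ++ p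
    split = rotate-split p (w ∷ s)
    orbit : w ∷ s ++ p ≡ iterate f w (suc (length (s ++ p))) × iterateℕ f w (suc (length (s ++ p))) ≡ w
    orbit = pathArcs-orbit f w (s ++ p) w
      (subst (Follows f) split (rotate-preserves (Follows f) rot-arcs (length p) _ follows))
    len : suc (length (s ++ p)) ≡ length (p ++ w ∷ s)
    len = xs↭ys⇒|xs|≡|ys| (subst (_↭ p ++ w ∷ s) split (rotate-↭ (length p) _))

  iterate-∈ : ∀ (f : A → A) {j m} x → j < m → iterateℕ f x j ∈ iterate f x m
  iterate-∈ f {zero} {suc m} x _ = here refl
  iterate-∈ f {suc j} {suc m} x (s≤s j<m) = there (iterate-∈ f (f x) j<m)

  orbit-repeats : ∀ (f : A → A) w {k k'} → 0 < k → k < k' → iterateℕ f w k ≡ w → ¬ Unique (iterate f w k')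
  orbit-repeats f w {suc k} {suc k'} _ (s≤s k<k') fᵏw≡w (w∉ AllPairs.∷ _) =
    All.lookup w∉ (subst (_∈ iterate f (f w) k') fᵏw≡w (iterate-∈ f (f w) k<k')) refl

  closed-orbit-length : ∀ (f : A → A) w k k' → 0 < k → 0 < k'
    → iterateℕ f w k ≡ w → iterateℕ f w k' ≡ w
    → Unique (iterate f w k) → Unique (iterate f w k') → k ≡ k'
  closed-orbit-length f w k k' 0<k 0<k' closed closed' u u' with <-cmp k k'
  ... | tri< k<k' _ _ = ⊥-elim (orbit-repeats f w 0<k k<k' closed u')
  ... | tri≈ _ k≡k' _ = k≡k'
  ... | tri> _ _ k'<k = ⊥-elim (orbit-repeats f w 0<k' k'<k closed' u)

  -- two duplicate-free cycles followed by the same map and sharing a vertex w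
  -- have a common rotation, namely the orbit of w
  common-rotation : ∀ (f : A → A) L M {w} → Unique L → Unique M → Follows f L → Follows f M
    → w ∈ L → w ∈ M → ∃[ k ] ∃[ k' ] rotate k L ≡ rotate k' M
  common-rotation f L M {w} uL uM fL fM w∈L w∈M
    with follows⇒orbit f L fL w∈L | follows⇒orbit f M fM w∈M
  ... | k , rotL≡orbit , closedL | k' , rotM≡orbit , closedM =
    k , k' , trans rotL≡orbit (trans (cong (iterate f w) same-length) (sym rotM≡orbit))
    where
    same-length : length L ≡ length M
    same-length = closed-orbit-length f w (length L) (length M) (∈-length w∈L) (∈-length w∈M)
      closedL closedM
      (subst Unique rotL≡orbit (Unique-resp-↭ (↭-sym (rotate-↭ k L)) uL))
      (subst Unique rotM≡orbit (Unique-resp-↭ (↭-sym (rotate-↭ k' M)) uM))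

  shared-vertex⇒⊆ : ∀ (f : A → A) {L M w} → Unique L → Unique M → Follows f L → Follows f M
    → w ∈ L → w ∈ M → ∀ {y} → y ∈ L → y ∈ M
  shared-vertex⇒⊆ f {L} {M} uL uM fL fM w∈L w∈M y∈L with common-rotation f L M uL uM fL fM w∈L w∈M
  ... | k , k' , rotations-agree =
    ∈-resp-↭ (rotate-↭ k' M) (subst (_ ∈_) rotations-agree (∈-resp-↭ (↭-sym (rotate-↭ k L)) y∈L))

  -- Reversal.  reverseCycle l traverses the cycle l backwards from the same start.

  reverseCycle : List A → List A
  reverseCycle [] = []
  reverseCycle (x ∷ xs) = x ∷ reverse xs

  reverseCycle-↭ : ∀ l → reverseCycle l ↭ l
  reverseCycle-↭ [] = ↭-refl
  reverseCycle-↭ (x ∷ xs) = ↭-prep x (↭-reverse xs)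

  ∈-reverseCycle : ∀ l {v} → v ∈ l → v ∈ reverseCycle l
  ∈-reverseCycle l = ∈-resp-↭ (↭-sym (reverseCycle-↭ l))

  unique-reverseCycle : ∀ l → Unique l → Unique (reverseCycle l)
  unique-reverseCycle l = Unique-resp-↭ (↭-sym (reverseCycle-↭ l))

  reversals-shared-vertex⇒⊆ : ∀ (f : A → A) {L M w} → Unique L → Unique M
    → Follows f (reverseCycle L) → Follows f (reverseCycle M) → w ∈ L → w ∈ M → ∀ {y} → y ∈ L → y ∈ M
  reversals-shared-vertex⇒⊆ f {L} {M} uL uM fL fM w∈L w∈M y∈L =
    ∈-resp-↭ (reverseCycle-↭ M)
      (shared-vertex⇒⊆ f (unique-reverseCycle L uL) (unique-reverseCycle M uM) fL fM
        (∈-reverseCycle L w∈L) (∈-reverseCycle M w∈M) (∈-reverseCycle L y∈L))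

  rot-reverseCycle : ∀ l → rot (reverseCycle l) ≡ reverse l
  rot-reverseCycle [] = refl
  rot-reverseCycle (x ∷ xs) = sym (unfold-reverse x xs)

  pathArcs-reverse : ∀ {P : A × A → Set} x xs z
    → (∀ {a b} → (a , b) ∈ pathArcs x xs z → P (b , a)) → All P (pathArcs z (reverse xs) x)
  pathArcs-reverse x [] z turned = turned (here refl) ∷ []
  pathArcs-reverse x (y ∷ ys) z turned rewrite unfold-reverse y ys =
    pathArcs-snoc z (reverse ys) y x (pathArcs-reverse y ys z (λ p → turned (there p))) (turned (here refl))

  reverseCycle-arcs : ∀ {P : A × A → Set} l
    → (∀ {a b} → (a , b) ∈ cyclicPairs l → P (b , a)) → All P (cyclicPairs (reverseCycle l))
  reverseCycle-arcs [] _ = []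
  reverseCycle-arcs (x ∷ xs) turned = pathArcs-reverse x xs x turned

-- For an assignment σ (σ[v] is the head of the arc leaving v) and a cycle l,
-- flipAlong σ l re-points every vertex of l to its predecessor on l, i.e. it
-- reverses the cycle, and agrees with σ elsewhere.

module _ {n : ℕ} where

  open PermutationProperties (setoid (Fin n)) using (∈-resp-↭)

  sameOriented-∈ : ∀ {l l' : List (Fin n)} {v} → SameOriented l l' → v ∈ l' → v ∈ l
  sameOriented-∈ {l} (i , refl) v∈l' = ∈-resp-↭ (drop++take-↭ i l) v∈l'

  predecessorIn : List (Fin n × Fin n) → Fin n → Maybe (Fin n)
  predecessorIn [] y = nothing
  predecessorIn ((a , b) ∷ arcs) y with b ≟F y
  ... | yes _ = just a
  ... | no _ = predecessorIn arcs y

  predecessorIn-just : ∀ arcs y {a} → predecessorIn arcs y ≡ just a → (a , y) ∈ arcs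
  predecessorIn-just ((a' , b) ∷ arcs) y found with b ≟F y
  predecessorIn-just ((a' , b) ∷ arcs) y refl | yes refl = here refl
  ... | no _ = there (predecessorIn-just arcs y found)

  predecessorIn-nothing : ∀ arcs y {a} → predecessorIn arcs y ≡ nothing → (a , y) ∉ arcs
  predecessorIn-nothing ((a' , b) ∷ arcs) y none arc with b ≟F y
  predecessorIn-nothing ((a' , b) ∷ arcs) y () arc | yes _
  predecessorIn-nothing ((a' , b) ∷ arcs) y none (here refl) | no b≢y = b≢y refl
  predecessorIn-nothing ((a' , b) ∷ arcs) y none (there arc) | no _ = predecessorIn-nothing arcs y none arc

  flipAlong : Vec (Fin n) n → List (Fin n) → Vec (Fin n) n
  flipAlong σ l = tabulate λ y → fromMaybe (lookup σ y) (predecessorIn (cyclicPairs l) y)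

  module _ (σ : Vec (Fin n) n) {l : List (Fin n)} (unique : Unique l) where

    flipAlong-arc : ∀ {a b} → (a , b) ∈ cyclicPairs l → lookup (flipAlong σ l) b ≡ a
    flipAlong-arc {b = b} arc
      rewrite lookup∘tabulate (λ y → fromMaybe (lookup σ y) (predecessorIn (cyclicPairs l) y)) b
      with predecessorIn (cyclicPairs l) b in found
    ... | just a' = predecessor-unique l unique (predecessorIn-just (cyclicPairs l) b found) arc
    ... | nothing = ⊥-elim (predecessorIn-nothing (cyclicPairs l) b found arc)

    flipAlong-outside : ∀ {y} → y ∉ l → lookup (flipAlong σ l) y ≡ lookup σ y
    flipAlong-outside {y} y∉l
      rewrite lookup∘tabulate (λ y → fromMaybe (lookup σ y) (predecessorIn (cyclicPairs l) y)) y
      with predecessorIn (cyclicPairs l) y in found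
    ... | just a = ⊥-elim (y∉l (proj₂ (arc-endpoints l (predecessorIn-just (cyclicPairs l) y found))))
    ... | nothing = refl

    flipAlong-inside : ∀ {y} → y ∈ l → lookup (flipAlong σ l) y ∈ l
    flipAlong-inside y∈l with predecessor-exists l y∈l
    ... | a , arc = subst (_∈ l) (sym (flipAlong-arc arc)) (proj₁ (arc-endpoints l arc))

    flipAlong-follows-reverse : Follows (lookup (flipAlong σ l)) (reverseCycle l)
    flipAlong-follows-reverse = reverseCycle-arcs l flipAlong-arc

    -- if σ follows l, σ is recovered on l from its flip: a flipped arc b → y is the arc y → b of σ
    flipAlong-recovers : Follows (lookup σ) l → ∀ {b y} → b ∈ l → lookup (flipAlong σ l) b ≡ y → lookup σ y ≡ b
    flipAlong-recovers follows b∈l τb≡y with predecessor-exists l b∈l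
    ... | a , arc = subst (λ a → lookup σ a ≡ _) (trans (sym (flipAlong-arc arc)) τb≡y) (All.lookup follows arc)

    flipAlong-follows-disjoint : ∀ {l'} → All (_∉ l) l' → Follows (lookup (flipAlong σ l)) l' → Follows (lookup σ) l'
    flipAlong-follows-disjoint {l'} avoids follows = All.tabulate λ arc →
      trans (sym (flipAlong-outside (All.lookup avoids (proj₁ (arc-endpoints l' arc))))) (All.lookup follows arc)

module _ {n : ℕ} (G : Graph n) where

  open PermutationProperties (setoid (Fin n)) using (Unique-resp-↭; xs↭ys⇒|xs|≡|ys|)
  open PermutationSetoid (setoid (Fin n)) using (↭-sym)

  isCycle-rot : ∀ {l} → IsCycle G l → IsCycle G (rot l)
  isCycle-rot {l} (3≤len , unique , adjacent) =
    subst (3 ≤_) (sym (xs↭ys⇒|xs|≡|ys| (rot-↭ l))) 3≤len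
    , Unique-resp-↭ (↭-sym (rot-↭ l)) unique
    , rot-arcs l adjacent

  isCycle-reverseCycle : (∀ u v → G u v ≡ G v u) → ∀ {l} → IsCycle G l → IsCycle G (reverseCycle l)
  isCycle-reverseCycle symmetric {l} (3≤len , unique , adjacent) =
    subst (3 ≤_) (sym (xs↭ys⇒|xs|≡|ys| (reverseCycle-↭ l))) 3≤len
    , unique-reverseCycle l unique
    , reverseCycle-arcs l (λ {a} {b} arc → trans (symmetric b a) (All.lookup adjacent arc))

  module _ {ch : List (Fin n) → Bool} (orientation : OrientationChoice G ch) where

    ch-rotate : ∀ k {l} → IsCycle G l → ch (rotate k l) ≡ ch l
    ch-rotate zero _ = refl
    ch-rotate (suc k) {l} cycle = trans (ch-rotate k (isCycle-rot cycle)) (proj₁ (orientation l cycle))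

    ch-common-rotation : ∀ k k' {l m} → IsCycle G l → IsCycle G m → rotate k l ≡ rotate k' m → ch l ≡ ch m
    ch-common-rotation k k' l-cycle m-cycle rotations-agree =
      trans (sym (ch-rotate k l-cycle)) (trans (cong ch rotations-agree) (ch-rotate k' m-cycle))

    ch-reverseCycle : ∀ {l} → IsCycle G l → IsCycle G (reverseCycle l) → ch (reverseCycle l) ≡ not (ch l)
    ch-reverseCycle {l} cycle reversed-cycle =
      begin
        ch (reverseCycle l)       ≡⟨ sym (proj₁ (orientation (reverseCycle l) reversed-cycle)) ⟩
        ch (rot (reverseCycle l)) ≡⟨ cong ch (rot-reverseCycle l) ⟩
        ch (reverse l)            ≡⟨ proj₂ (orientation l cycle) ⟩
        not (ch l)
      ∎
      where open ≡-Reasoning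

module _ {n : ℕ} {G : Graph n} (symmetric : ∀ u v → G u v ≡ G v u)
         {ch : List (Fin n) → Bool} (orientation : OrientationChoice G ch) where

  open DecMembership (_≟F_ {n}) using (_∈?_)

  module _ {σ : Vec (Fin n) n} {l : List (Fin n)} (l-cycle : IsCycle G l) (l-chosen : ch l ≡ true)
           (σ-assignment : IsAssignment G σ) (σ-follows : BCycleSeq σ l) (σ-no-edge : ¬ BEdge G σ)
           (σ-only-l : ∀ l' → ChosenCycle G ch l' → BCycleSeq σ l' → SameOriented l l') where

    l-unique : Unique l
    l-unique = proj₁ (proj₂ l-cycle)

    -- each vertex of l now points to its predecessor, a neighbour by symmetry
    flip-assignment : IsAssignment G (flipAlong σ l)
    flip-assignment y with y ∈? l
    ... | no y∉l = subst (Adj G y) (sym (flipAlong-outside σ l-unique y∉l)) (σ-assignment y)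
    ... | yes y∈l with predecessor-exists l y∈l
    ...   | a , arc = subst (Adj G y) (sym (flipAlong-arc σ l-unique arc))
                        (trans (symmetric y a) (All.lookup (proj₂ (proj₂ l-cycle)) arc))

    -- an edge event of the flip would be one of σ: on l the flip reverses the arcs of σ
    flip-no-edge : ¬ BEdge G (flipAlong σ l)
    flip-no-edge (u , v , u~v , τu≡v , τv≡u) with u ∈? l | v ∈? l
    ... | yes u∈l | _ =
      σ-no-edge (u , v , u~v , flipAlong-recovers σ l-unique σ-follows v∈l τv≡u
                             , flipAlong-recovers σ l-unique σ-follows u∈l τu≡v)
      where
      v∈l : v ∈ l
      v∈l = subst (_∈ l) τu≡v (flipAlong-inside σ l-unique u∈l)
    ... | no u∉l | yes v∈l = u∉l (subst (_∈ l) τv≡u (flipAlong-inside σ l-unique v∈l))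
    ... | no u∉l | no v∉l =
      σ-no-edge (u , v , u~v , trans (sym (flipAlong-outside σ l-unique u∉l)) τu≡v
                             , trans (sym (flipAlong-outside σ l-unique v∉l)) τv≡u)

    reversed-cycle : IsCycle G (reverseCycle l)
    reversed-cycle = isCycle-reverseCycle G symmetric l-cycle

    reversal-not-chosen : ch (reverseCycle l) ≡ false
    reversal-not-chosen =
      trans (ch-reverseCycle G orientation l-cycle reversed-cycle) (cong not l-chosen)

    -- a chosen cycle followed by the flip cannot meet l: it would share a
    -- rotation with the reversal of l, hence have the same orientation
    flip-cycle-avoids : ∀ {l'} → ChosenCycle G ch l' → BCycleSeq (flipAlong σ l) l' → ¬ Any (_∈ l) l'
    flip-cycle-avoids {l'} (l'-cycle , l'-chosen) follows meets with find meets
    ... | w , w∈l' , w∈l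
      with common-rotation (lookup (flipAlong σ l)) l' (reverseCycle l)
             (proj₁ (proj₂ l'-cycle)) (proj₁ (proj₂ reversed-cycle))
             follows (flipAlong-follows-reverse σ l-unique)
             w∈l' (∈-reverseCycle l w∈l)
    ... | k , k' , rotations-agree
      with trans (sym l'-chosen)
             (trans (ch-common-rotation G orientation k k' l'-cycle reversed-cycle rotations-agree)
                    reversal-not-chosen)
    ... | ()

    -- a chosen cycle avoiding l followed by the flip is followed by σ, so it is
    -- a rotation of l by uniqueness of the cycle event in Ω_C, yet avoids l
    flip-no-chosen-cycle : ∀ l' → ChosenCycle G ch l' → ¬ BCycleSeq (flipAlong σ l) l'
    flip-no-chosen-cycle [] ((() , _) , _) _
    flip-no-chosen-cycle (v ∷ l') chosen' follows =
      All.lookup avoids (here refl) (sameOriented-∈ (σ-only-l (v ∷ l') chosen' σ-follows-l') (here refl))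
      where
      avoids : All (_∉ l) (v ∷ l')
      avoids = ¬Any⇒All¬ (v ∷ l') (flip-cycle-avoids chosen' follows)
      σ-follows-l' : BCycleSeq σ (v ∷ l')
      σ-follows-l' = flipAlong-follows-disjoint σ l-unique avoids follows

  flipAlong-Ω₀ : ∀ {σ l} → ChosenCycle G ch l → ΩC G ch l σ → Ω₀ G ch (flipAlong σ l)
  flipAlong-Ω₀ {σ} (l-cycle , l-chosen) (σ-assignment , σ-follows , σ-no-edge , σ-only-l) =
    flip-assignment {σ = σ} l-cycle l-chosen σ-assignment σ-follows σ-no-edge σ-only-l
    , flip-no-edge {σ = σ} l-cycle l-chosen σ-assignment σ-follows σ-no-edge σ-only-l
    , flip-no-chosen-cycle {σ = σ} l-cycle l-chosen σ-assignment σ-follows σ-no-edge σ-only-l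

  FlipsTo : Vec (Fin n) n × Fin n → Vec (Fin n) n × Fin n → Set
  FlipsTo (σ , v) (τ , w) =
    w ≡ v × ∃[ l ] (ChosenCycle G ch l × ΩC G ch l σ × v ∈ l × τ ≡ flipAlong σ l)

  -- (σ , v) is recovered from its flip: the two cycles are reversed by the same
  -- τ and share v, so they have the same vertices; off them σ = τ, and on them
  -- σ is read off τ backwards
  flipsTo-injective : ∀ {x x' y} → FlipsTo x y → FlipsTo x' y → x ≡ x'
  flipsTo-injective {σ₁ , v} {σ₂ , _} (refl , l₁ , (c₁ , _) , (_ , f₁ , _) , v∈l₁ , refl)
                                     (refl , l₂ , (c₂ , _) , (_ , f₂ , _) , v∈l₂ , flips-agree) =
    cong (_, v) (trans (sym (tabulate∘lookup σ₁)) (trans (tabulate-cong agree) (tabulate∘lookup σ₂)))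
    where
    u₁ : Unique l₁
    u₁ = proj₁ (proj₂ c₁)
    u₂ : Unique l₂
    u₂ = proj₁ (proj₂ c₂)
    τ : Vec (Fin n) n
    τ = flipAlong σ₁ l₁

    τ-follows-reversal₁ : Follows (lookup τ) (reverseCycle l₁)
    τ-follows-reversal₁ = flipAlong-follows-reverse σ₁ u₁
    τ-follows-reversal₂ : Follows (lookup τ) (reverseCycle l₂)
    τ-follows-reversal₂ = subst (λ t → Follows (lookup t) (reverseCycle l₂)) (sym flips-agree)
                            (flipAlong-follows-reverse σ₂ u₂)

    l₁⊆l₂ : ∀ {y} → y ∈ l₁ → y ∈ l₂
    l₁⊆l₂ = reversals-shared-vertex⇒⊆ (lookup τ) u₁ u₂ τ-follows-reversal₁ τ-follows-reversal₂ v∈l₁ v∈l₂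

    l₂⊆l₁ : ∀ {y} → y ∈ l₂ → y ∈ l₁
    l₂⊆l₁ = reversals-shared-vertex⇒⊆ (lookup τ) u₂ u₁ τ-follows-reversal₂ τ-follows-reversal₁ v∈l₂ v∈l₁

    -- off the cycle σ₁ = τ = σ₂; on it, σ₁ y and σ₂ y are both the b with τ b = y
    agree : ∀ y → lookup σ₁ y ≡ lookup σ₂ y
    agree y with y ∈? l₁
    ... | no y∉l₁ =
      trans (sym (flipAlong-outside σ₁ u₁ y∉l₁))
        (trans (cong (λ t → lookup t y) flips-agree) (flipAlong-outside σ₂ u₂ (λ y∈l₂ → y∉l₁ (l₂⊆l₁ y∈l₂))))
    ... | yes y∈l₁ with successor-exists l₂ (l₁⊆l₂ y∈l₁)
    ...   | b , arc = trans (flipAlong-recovers σ₁ u₁ f₁ (l₂⊆l₁ b∈l₂) τb≡y) (sym (All.lookup f₂ arc))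
      where
      b∈l₂ : b ∈ l₂
      b∈l₂ = proj₂ (arc-endpoints l₂ arc)
      τb≡y : lookup τ b ≡ y
      τb≡y = trans (cong (λ t → lookup t b) flips-agree) (flipAlong-arc σ₂ u₂ arc)

-- The theorem.  The flip map injects Ω_cycle^var into Ω₀ × V, which has
-- n |Ω₀| elements.

lemma3p2 : (n : ℕ) (G : Graph n) → IsSimple G → Connected G → n ≤ edgeCount G
    → (ch : List (Fin n) → Bool) → OrientationChoice G ch
    → (d₀ : Decidable (Ω₀ G ch)) (dv : Decidable (ΩcycleVar G ch))
    → count dv (cartesianProduct (allMaps n) (allFin n)) ≤ n * count d₀ (allMaps n)
lemma3p2 n G (symmetric , _) _ _ ch orientation d₀ dv =
  begin
    count dv pairs
  ≤⟨ length-≤-by-injection pair-≟ (FlipsTo symmetric orientation) (filter dv pairs) (filter Ω₀-first pairs)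
       (filter⁺ dv pairs-unique) flip-into-Ω₀ (flipsTo-injective symmetric orientation) ⟩
    count Ω₀-first pairs
  ≡⟨ count-first d₀ (allMaps n) (allFin n) ⟩
    length (allFin n) * count d₀ (allMaps n)
  ≡⟨ cong (_* count d₀ (allMaps n)) (length-tabulate {n = n} (λ i → i)) ⟩
    n * count d₀ (allMaps n)
  ∎
  where
  open ≤-Reasoning
  pairs : List (Vec (Fin n) n × Fin n)
  pairs = cartesianProduct (allMaps n) (allFin n)
  Ω₀-first : Decidable (λ (p : Vec (Fin n) n × Fin n) → Ω₀ G ch (proj₁ p))
  Ω₀-first p = d₀ (proj₁ p)
  pair-≟ : DecidableEquality (Vec (Fin n) n × Fin n)
  pair-≟ = Product.≡-dec (Vec.≡-dec _≟F_) _≟F_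
  pairs-unique : Unique pairs
  pairs-unique = cartesianProduct⁺ (unique-allVecs (allFin n) (allFin⁺ n) n) (allFin⁺ n)

  flip-into-Ω₀ : ∀ {x} → x ∈ filter dv pairs → ∃ λ y → y ∈ filter Ω₀-first pairs × FlipsTo symmetric orientation x y
  flip-into-Ω₀ {σ , v} x∈ with proj₂ (∈-filter⁻ dv {xs = pairs} x∈)
  ... | l , chosen , σ∈ΩC , v∈l =
    (flipAlong σ l , v)
    , ∈-filter⁺ Ω₀-first (∈-cartesianProduct⁺ (∈-allVecs (allFin n) ∈-allFin n (flipAlong σ l)) (∈-allFin v))
                (flipAlong-Ω₀ symmetric orientation {σ = σ} chosen σ∈ΩC)
    , refl , l , chosen , σ∈ΩC , v∈l , refl
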